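{- For all $n\ge1$ and $\omega_1,\dots,\omega_n\in W$, $$R[\omega_1|\cdots|\omega_n]=\sum_{i=1}^n(-1)^{n-i}\Big[\,[\omega_1|\cdots|\omega_{i-1}]\ \text{\rm ш}\ [\omega^\infty_n|\cdots|\omega^\infty_{i+1}]\ \Big|\ \omega^0_i\Big].$$
   Context: Let $W$ be a $\mathbb Q$-vector space with a decomposition $W\cong W^0\oplus W^\infty$ given by projections $\pi^0,\pi^\infty$; write $w^0=\pi^0(w)$, $w^\infty=\pi^\infty(w)$. $T^c(W)$ is the tensor coalgebra on $W$ with basis of words $[w_1|\cdots|w_n]$, equipped with the shuffle product ш, the deconcatenation coproduct $\Delta[w_1|\cdots|w_n]=\sum_{i=0}^n[w_1|\cdots|w_i]\otimes[w_{i+1}|\cdots|w_n]$, and antipode $S[w_1|\cdots|w_n]=(-1)^n[w_n|\cdots|w_1]$. Let $R=\text{ш}\circ(\mathrm{id}\otimes\pi^\infty S)\circ\Delta$, where $\pi^\infty$ is applied letterwise; explicitly $R[\omega_1|\cdots|\omega_n]=\sum_{i=0}^n(-1)^{n-i}[\omega_1|\cdots|\omega_i]\,\text{ш}\,[\omega^\infty_n|\cdots|\omega^\infty_{i+1}]$. For a linear combination $A$ of words and a letter $b$, $[A\,|\,b]$ denotes the linear extension of appending $b$ at the end of each word. -}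

module Defs where

open import Level using (Level; _⊔_)
open import Data.Nat using (ℕ; zero; suc; _∸_)
open import Data.Fin using (Fin; toℕ)
open import Data.Product using (_×_; _,_)
open import Data.List using (List; []; _∷_; _++_; [_]; map; concatMap; take; drop; reverse; length; lookup; upTo; allFin)
open import Data.List.Relation.Binary.Pointwise using (Pointwise)
open import Data.Rational using (ℚ; 0ℚ; 1ℚ; -_) renaming (_+_ to _+ℚ_; _*_ to _*ℚ_)
open import Data.Rational.Properties using (+-*-commutativeRing)
open import Algebra.Module.Bundles using (Module)

QVectorSpace : (m ℓ : Level) → Set _
QVectorSpace m ℓ = Module +-*-commutativeRing m ℓ

-- A decomposition W ≅ W⁰ ⊕ W^∞ given by two complementary linear projections.
record Decomposition {m ℓ : Level} (W : QVectorSpace m ℓ) : Set (m ⊔ ℓ) where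
  open Module W
  field
    π⁰ π∞ : Carrierᴹ → Carrierᴹ
    π⁰-cong : ∀ {x y} → x ≈ᴹ y → π⁰ x ≈ᴹ π⁰ y
    π∞-cong : ∀ {x y} → x ≈ᴹ y → π∞ x ≈ᴹ π∞ y
    π⁰-+ : ∀ x y → π⁰ (x +ᴹ y) ≈ᴹ π⁰ x +ᴹ π⁰ y
    π∞-+ : ∀ x y → π∞ (x +ᴹ y) ≈ᴹ π∞ x +ᴹ π∞ y
    π⁰-* : ∀ (c : ℚ) x → π⁰ (c *ₗ x) ≈ᴹ c *ₗ π⁰ x
    π∞-* : ∀ (c : ℚ) x → π∞ (c *ₗ x) ≈ᴹ c *ₗ π∞ x
    π-sum : ∀ x → π⁰ x +ᴹ π∞ x ≈ᴹ x
    π⁰π∞ : ∀ x → π⁰ (π∞ x) ≈ᴹ 0ᴹ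
    π∞π⁰ : ∀ x → π∞ (π⁰ x) ≈ᴹ 0ᴹ

-- The tensor coalgebra T^c(W) as a vector space: formal ℚ-linear
-- combinations of words, modulo the relation generated by the module
-- axioms and multilinearity in each letter (i.e. ⊕ₙ W^{⊗n}).
module TensorCoalgebra {m ℓ : Level} (W : QVectorSpace m ℓ) (D : Decomposition W) where
  open Module W
  open Decomposition D

  Word : Set m
  Word = List Carrierᴹ

  -- finite formal linear combination Σ qₖ [wₖ]; list concatenation is the sum
  Comb : Set m
  Comb = List (ℚ × Word)

  word : Word → Comb
  word w = [ (1ℚ , w) ]

  scale : ℚ → Comb → Comb
  scale q = map (λ { (p , w) → (q *ℚ p , w) })

  infix 4 _≈T_
  data _≈T_ : Comb → Comb → Set (m ⊔ ℓ) where
    ≈-refl  : ∀ {c} → c ≈T c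
    ≈-sym   : ∀ {c d} → c ≈T d → d ≈T c
    ≈-trans : ∀ {c d e} → c ≈T d → d ≈T e → c ≈T e
    ++-cong : ∀ {c c′ d d′} → c ≈T c′ → d ≈T d′ → c ++ d ≈T c′ ++ d′
    ++-comm : ∀ c d → c ++ d ≈T d ++ c
    scale-cong : ∀ q {c d} → c ≈T d → scale q c ≈T scale q d
    zero-coef : ∀ w → [ (0ℚ , w) ] ≈T []
    coef-add : ∀ p q w → (p , w) ∷ (q , w) ∷ [] ≈T [ (p +ℚ q , w) ]
    letter-cong : ∀ q {u v} → Pointwise _≈ᴹ_ u v → [ (q , u) ] ≈T [ (q , v) ]
    lin-add : ∀ q u x y v →
      [ (q , u ++ (x +ᴹ y) ∷ v) ] ≈T (q , u ++ x ∷ v) ∷ (q , u ++ y ∷ v) ∷ []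
    lin-scal : ∀ q u c x v →
      [ (q , u ++ (c *ₗ x) ∷ v) ] ≈T [ (q *ℚ c , u ++ x ∷ v) ]

  prefix : Carrierᴹ → Comb → Comb
  prefix a = map (λ { (q , w) → (q , a ∷ w) })

  [_∣_] : Comb → Carrierᴹ → Comb
  [ A ∣ b ] = map (λ { (q , w) → (q , w ++ [ b ]) }) A

  shW : Word → Word → Comb
  shW [] v = word v
  shW (a ∷ u) [] = word (a ∷ u)
  shW (a ∷ u) (b ∷ v) = prefix a (shW u (b ∷ v)) ++ prefix b (shW (a ∷ u) v)

  infixl 7 _ш_
  _ш_ : Comb → Comb → Comb
  A ш B = concatMap (λ { (p , u) → concatMap (λ { (q , v) → scale (p *ℚ q) (shW u v) }) B }) A

  sgn : ℕ → ℚ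
  sgn zero = 1ℚ
  sgn (suc k) = - sgn k

  π∞W : Word → Word
  π∞W = map π∞

  R : Word → Comb
  R ω = concatMap
    (λ i → scale (sgn (length ω ∸ i)) (word (take i ω) ш word (reverse (π∞W (drop i ω)))))
    (upTo (suc (length ω)))

  -- Σ_{i=1}^{n} (-1)^{n-i} [ [ω₁|⋯|ω_{i-1}] ш [ω^∞ₙ|⋯|ω^∞_{i+1}] | ω⁰ᵢ ]
  -- (index i = suc (toℕ j) for j : Fin n, so ωᵢ = lookup ω j)
  RHS : Word → Comb
  RHS ω = concatMap
    (λ (j : Fin (length ω)) →
      scale (sgn (length ω ∸ suc (toℕ j)))
        [ word (take (toℕ j) ω) ш word (reverse (π∞W (drop (suc (toℕ j)) ω))) ∣ π⁰ (lookup ω j) ])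
    (allFin (length ω))

{-# OPTIONS --safe #-}
module Submission where

-- Split each shuffle [ω₁|⋯|ωᵢ] ш [ω^∞ₙ|⋯|ω^∞ᵢ₊₁] according to whether its last letter is ωᵢ
-- or ω^∞ᵢ₊₁. The piece ending in ω^∞ᵢ₊₁ has the same shuffle in front as the piece of the
-- (i+1)-st term ending in ωᵢ₊₁, with the opposite sign; since ωᵢ₊₁ = ω⁰ᵢ₊₁ + ω^∞ᵢ₊₁ and words
-- are linear in their last letter, the two combine into the ω⁰ᵢ₊₁-term of the right-hand side.
-- The i = 0 term has only a piece of the second kind and the i = n term only one of the first,
-- so the sum telescopes to the right-hand side.

open import Defs
open import Level using (Level; _⊔_)
open import Data.Nat using (ℕ; suc; _∸_; _≤_)
open import Data.Fin using (Fin; toℕ) renaming (zero to fzero; suc to fsuc)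
open import Data.Product using (_,_)
open import Data.List using (List; []; _∷_; _++_; [_]; concatMap; take; drop; reverse; length; lookup; upTo; allFin)
open import Data.List.Properties using (map-++; map-upTo; map-tabulate; concatMap-cong; concatMap-map; unfold-reverse)
import Data.List.Properties as List
import Data.List.Relation.Binary.Pointwise as Pointwise
open Pointwise using ([]; _∷_)
open import Data.Rational using (0ℚ; 1ℚ; -_) renaming (_+_ to _+ℚ_; _*_ to _*ℚ_)
import Data.Rational.Properties as ℚ
open import Relation.Binary.PropositionalEquality using (_≡_; refl; sym; trans; cong; cong₂)
open import Relation.Binary.Structures using (IsEquivalence)
open import Algebra.Bundles using (CommutativeMonoid)
open import Algebra.Structures using (IsCommutativeMonoid)
open import Algebra.Module.Bundles using (Module)
import Algebra.Properties.CommutativeSemigroup as CommutativeSemigroupProperties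
import Relation.Binary.Reasoning.Setoid as SetoidReasoning

concatMap-upTo-suc : ∀ {a} {A : Set a} (F : ℕ → List A) n →
  concatMap F (upTo (suc n)) ≡ F 0 ++ concatMap (λ i → F (suc i)) (upTo n)
concatMap-upTo-suc F n =
  cong (F 0 ++_) (trans (cong (concatMap F) (sym (map-upTo suc n))) (concatMap-map F suc (upTo n)))

concatMap-allFin-suc : ∀ {a} {A : Set a} n (G : Fin (suc n) → List A) →
  concatMap G (allFin (suc n)) ≡ G fzero ++ concatMap (λ j → G (fsuc j)) (allFin n)
concatMap-allFin-suc n G =
  cong (G fzero ++_)
    (trans (cong (concatMap G) (sym (map-tabulate (λ j → j) fsuc))) (concatMap-map G fsuc (allFin n)))

module _ {m ℓ : Level} (W : QVectorSpace m ℓ) (D : Decomposition W) where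
  open Module W using (≈ᴹ-refl; ≈ᴹ-sym)
  open Decomposition D
  open TensorCoalgebra W D

  ≡⇒≈T : ∀ {c d} → c ≡ d → c ≈T d
  ≡⇒≈T refl = ≈-refl

  ≈T-isEquivalence : IsEquivalence _≈T_
  ≈T-isEquivalence = record { refl = ≈-refl ; sym = ≈-sym ; trans = ≈-trans }

  ++-isCommutativeMonoid : IsCommutativeMonoid _≈T_ _++_ []
  ++-isCommutativeMonoid = record
    { isMonoid = record
      { isSemigroup = record
        { isMagma = record { isEquivalence = ≈T-isEquivalence ; ∙-cong = ++-cong }
        ; assoc = λ c d e → ≡⇒≈T (List.++-assoc c d e)
        }
      ; identity = (λ _ → ≈-refl) , (λ c → ≡⇒≈T (List.++-identityʳ c))
      }
    ; comm = ++-comm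
    }

  ++-commutativeMonoid : CommutativeMonoid m (m ⊔ ℓ)
  ++-commutativeMonoid = record { isCommutativeMonoid = ++-isCommutativeMonoid }

  open CommutativeMonoid ++-commutativeMonoid using (setoid; assoc; ∙-congˡ; ∙-congʳ; identityʳ)
  open CommutativeSemigroupProperties (CommutativeMonoid.commutativeSemigroup ++-commutativeMonoid)
    using (interchange; x∙yz≈y∙xz; xy∙z≈xz∙y)
  open SetoidReasoning setoid

  prefix-++ : ∀ a c d → prefix a (c ++ d) ≡ prefix a c ++ prefix a d
  prefix-++ a = map-++ _

  append-++ : ∀ c d b → [ c ++ d ∣ b ] ≡ [ c ∣ b ] ++ [ d ∣ b ]
  append-++ c d b = map-++ _ c d

  scale-++ : ∀ q c d → scale q (c ++ d) ≡ scale q c ++ scale q d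
  scale-++ q = map-++ _

  prefix-scale : ∀ a q c → prefix a (scale q c) ≡ scale q (prefix a c)
  prefix-scale a q [] = refl
  prefix-scale a q (_ ∷ c) = cong (_ ∷_) (prefix-scale a q c)

  prefix-append : ∀ a c b → prefix a [ c ∣ b ] ≡ [ prefix a c ∣ b ]
  prefix-append a [] b = refl
  prefix-append a (_ ∷ c) b = cong (_ ∷_) (prefix-append a c b)

  prefix-append-++ : ∀ x c a d b → prefix x ([ c ∣ a ] ++ [ d ∣ b ]) ≡ [ prefix x c ∣ a ] ++ [ prefix x d ∣ b ]
  prefix-append-++ x c a d b =
    trans (prefix-++ x [ c ∣ a ] [ d ∣ b ]) (cong₂ _++_ (prefix-append x c a) (prefix-append x d b))

  scale-one : ∀ c → scale 1ℚ c ≡ c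
  scale-one [] = refl
  scale-one ((p , w) ∷ c) = cong₂ _∷_ (cong (_, w) (ℚ.*-identityˡ p)) (scale-one c)

  prefix-cong : ∀ a {c d} → c ≈T d → prefix a c ≈T prefix a d
  prefix-cong a ≈-refl = ≈-refl
  prefix-cong a (≈-sym p) = ≈-sym (prefix-cong a p)
  prefix-cong a (≈-trans p q) = ≈-trans (prefix-cong a p) (prefix-cong a q)
  prefix-cong a (++-cong {c} {c′} {d} {d′} p q)
    rewrite prefix-++ a c d | prefix-++ a c′ d′ = ++-cong (prefix-cong a p) (prefix-cong a q)
  prefix-cong a (++-comm c d)
    rewrite prefix-++ a c d | prefix-++ a d c = ++-comm (prefix a c) (prefix a d)
  prefix-cong a (scale-cong q {c} {d} p)
    rewrite prefix-scale a q c | prefix-scale a q d = scale-cong q (prefix-cong a p)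
  prefix-cong a (zero-coef w) = zero-coef (a ∷ w)
  prefix-cong a (coef-add p q w) = coef-add p q (a ∷ w)
  prefix-cong a (letter-cong q u≈v) = letter-cong q (≈ᴹ-refl ∷ u≈v)
  prefix-cong a (lin-add q u x y v) = lin-add q (a ∷ u) x y v
  prefix-cong a (lin-scal q u c x v) = lin-scal q (a ∷ u) c x v

  word-ш-word : ∀ u v → word u ш word v ≡ shW u v
  word-ш-word u v = trans (List.++-identityʳ _) (trans (List.++-identityʳ _)
    (trans (cong (λ q → scale q (shW u v)) (ℚ.*-identityˡ 1ℚ)) (scale-one (shW u v))))

  shW-[] : ∀ u → shW u [] ≡ word u
  shW-[] [] = refl
  shW-[] (_ ∷ _) = refl

  shW-∷ʳ : ∀ u v a b →
    shW (u ++ [ a ]) (v ++ [ b ]) ≈T [ shW u (v ++ [ b ]) ∣ a ] ++ [ shW (u ++ [ a ]) v ∣ b ]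
  shW-∷ʳ [] [] a b = ++-comm (word (a ∷ b ∷ [])) (word (b ∷ a ∷ []))
  shW-∷ʳ [] (y ∷ v) a b = begin
      ayvb ++ prefix y (shW [ a ] (v ++ [ b ]))
    ≈⟨ ∙-congˡ {ayvb} (prefix-cong y (shW-∷ʳ [] v a b)) ⟩
      ayvb ++ (yvba ++ prefix y [ shW [ a ] v ∣ b ])
    ≡⟨ cong (λ c → ayvb ++ (yvba ++ c)) (prefix-append y (shW [ a ] v) b) ⟩
      ayvb ++ (yvba ++ [ prefix y (shW [ a ] v) ∣ b ])
    ≈⟨ x∙yz≈y∙xz ayvb yvba [ prefix y (shW [ a ] v) ∣ b ] ⟩
      yvba ++ (ayvb ++ [ prefix y (shW [ a ] v) ∣ b ]) ∎
    where
    ayvb = word (a ∷ y ∷ v ++ [ b ])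
    yvba = word (y ∷ (v ++ [ b ]) ++ [ a ])
  shW-∷ʳ (x ∷ u) [] a b = begin
      prefix x (shW (u ++ [ a ]) [ b ]) ++ bxua
    ≈⟨ ∙-congʳ (prefix-cong x (shW-∷ʳ u [] a b)) ⟩
      prefix x ([ shW u [ b ] ∣ a ] ++ [ shW (u ++ [ a ]) [] ∣ b ]) ++ bxua
    ≡⟨ cong (_++ bxua) (trans (prefix-append-++ x (shW u [ b ]) a (shW (u ++ [ a ]) []) b)
                              (cong (λ c → P ++ [ prefix x c ∣ b ]) (shW-[] (u ++ [ a ])))) ⟩
      (P ++ xuab) ++ bxua
    ≈⟨ xy∙z≈xz∙y P xuab bxua ⟩
      (P ++ bxua) ++ xuab
    ≡⟨ cong (_++ xuab) (append-++ (prefix x (shW u [ b ])) (prefix b (word (x ∷ u))) a) ⟨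
      [ prefix x (shW u [ b ]) ++ prefix b (word (x ∷ u)) ∣ a ] ++ xuab ∎
    where
    P = [ prefix x (shW u [ b ]) ∣ a ]
    xuab = word (x ∷ (u ++ [ a ]) ++ [ b ])
    bxua = word (b ∷ x ∷ u ++ [ a ])
  shW-∷ʳ (x ∷ u) (y ∷ v) a b = begin
      prefix x (shW (u ++ [ a ]) (y ∷ v ++ [ b ])) ++ prefix y (shW (x ∷ u ++ [ a ]) (v ++ [ b ]))
    ≈⟨ ++-cong (prefix-cong x (shW-∷ʳ u (y ∷ v) a b)) (prefix-cong y (shW-∷ʳ (x ∷ u) v a b)) ⟩
      prefix x ([ S₁ ∣ a ] ++ [ S₃ ∣ b ]) ++ prefix y ([ S₂ ∣ a ] ++ [ S₄ ∣ b ])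
    ≡⟨ cong₂ _++_ (prefix-append-++ x S₁ a S₃ b) (prefix-append-++ y S₂ a S₄ b) ⟩
      (P₁ ++ P₃) ++ (P₂ ++ P₄)
    ≈⟨ interchange P₁ P₃ P₂ P₄ ⟩
      (P₁ ++ P₂) ++ (P₃ ++ P₄)
    ≡⟨ cong₂ _++_ (append-++ (prefix x S₁) (prefix y S₂) a) (append-++ (prefix x S₃) (prefix y S₄) b) ⟨
      [ prefix x S₁ ++ prefix y S₂ ∣ a ] ++ [ prefix x S₃ ++ prefix y S₄ ∣ b ] ∎
    where
    S₁ = shW u (y ∷ v ++ [ b ])
    S₂ = shW (x ∷ u) (v ++ [ b ])
    S₃ = shW (u ++ [ a ]) (y ∷ v)
    S₄ = shW (x ∷ u ++ [ a ]) v
    P₁ = [ prefix x S₁ ∣ a ]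
    P₂ = [ prefix y S₂ ∣ a ]
    P₃ = [ prefix x S₃ ∣ b ]
    P₄ = [ prefix y S₄ ∣ b ]

  append-π⁰-π∞ : ∀ S x → [ S ∣ x ] ≈T [ S ∣ π⁰ x ] ++ [ S ∣ π∞ x ]
  append-π⁰-π∞ [] x = ≈-refl
  append-π⁰-π∞ ((q , w) ∷ S) x = ≈-trans (++-cong split-last (append-π⁰-π∞ S x))
    (interchange [ (q , w ++ [ π⁰ x ]) ] [ (q , w ++ [ π∞ x ]) ] [ S ∣ π⁰ x ] [ S ∣ π∞ x ])
    where
    split-last : [ (q , w ++ [ x ]) ] ≈T (q , w ++ [ π⁰ x ]) ∷ [ (q , w ++ [ π∞ x ]) ]
    split-last = ≈-trans
      (letter-cong q (Pointwise.++⁺ (Pointwise.refl ≈ᴹ-refl) (≈ᴹ-sym (π-sum x) ∷ [])))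
      (lin-add q w (π⁰ x) (π∞ x) [])

  scale-neg-cancel : ∀ c A → scale (- c) A ++ scale c A ≈T []
  scale-neg-cancel c [] = ≈-refl
  scale-neg-cancel c ((q , w) ∷ A) =
    ≈-trans (interchange [ _ ] (scale (- c) A) [ _ ] (scale c A))
            (++-cong opposite-coefficients (scale-neg-cancel c A))
    where
    sum≡0 : (- c) *ℚ q +ℚ c *ℚ q ≡ 0ℚ
    sum≡0 = trans (cong (_+ℚ c *ℚ q) (sym (ℚ.neg-distribˡ-* c q))) (ℚ.+-inverseˡ (c *ℚ q))
    opposite-coefficients : ((- c) *ℚ q , w) ∷ [ (c *ℚ q , w) ] ≈T []
    opposite-coefficients =
      ≈-trans (coef-add _ _ w) (≈-trans (≡⇒≈T (cong (λ r → [ (r , w) ]) sum≡0)) (zero-coef w))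

  sgn-telescope : ∀ k S x →
    scale (sgn (suc k)) [ S ∣ π∞ x ] ++ scale (sgn k) [ S ∣ x ] ≈T scale (sgn k) [ S ∣ π⁰ x ]
  sgn-telescope k S x = begin
      Y′ ++ scale (sgn k) [ S ∣ x ]
    ≈⟨ ∙-congˡ (scale-cong (sgn k) (append-π⁰-π∞ S x)) ⟩
      Y′ ++ scale (sgn k) ([ S ∣ π⁰ x ] ++ [ S ∣ π∞ x ])
    ≡⟨ cong (Y′ ++_) (scale-++ (sgn k) [ S ∣ π⁰ x ] [ S ∣ π∞ x ]) ⟩
      Y′ ++ (X ++ Y)
    ≈⟨ x∙yz≈y∙xz Y′ X Y ⟩
      X ++ (Y′ ++ Y)
    ≈⟨ ∙-congˡ (scale-neg-cancel (sgn k) [ S ∣ π∞ x ]) ⟩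
      X ++ []
    ≈⟨ identityʳ X ⟩
      X ∎
    where
    Y′ = scale (sgn (suc k)) [ S ∣ π∞ x ]
    X = scale (sgn k) [ S ∣ π⁰ x ]
    Y = scale (sgn k) [ S ∣ π∞ x ]

  -- Rₚ q ω (resp. RHSₚ q ω) is the part of R (q ++ ω) (resp. RHS (q ++ ω)) made of the terms
  -- with index i ≥ length q (resp. i > length q).
  Rterm : Word → Word → ℕ → Comb
  Rterm q ω i = scale (sgn (length ω ∸ i)) (word (q ++ take i ω) ш word (reverse (π∞W (drop i ω))))

  Rₚ : Word → Word → Comb
  Rₚ q ω = concatMap (Rterm q ω) (upTo (suc (length ω)))

  RHSterm : Word → (ω : Word) → Fin (length ω) → Comb
  RHSterm q ω j = scale (sgn (length ω ∸ suc (toℕ j)))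
    [ word (q ++ take (toℕ j) ω) ш word (reverse (π∞W (drop (suc (toℕ j)) ω))) ∣ π⁰ (lookup ω j) ]

  RHSₚ : Word → Word → Comb
  RHSₚ q ω = concatMap (RHSterm q ω) (allFin (length ω))

  Rₚ-∷ : ∀ q x ω → Rₚ q (x ∷ ω) ≡
    scale (sgn (suc (length ω))) (shW q (reverse (π∞W ω) ++ [ π∞ x ])) ++ Rₚ (q ++ [ x ]) ω
  Rₚ-∷ q x ω = trans (concatMap-upTo-suc (Rterm q (x ∷ ω)) (suc (length ω)))
    (cong₂ _++_ (cong (scale (sgn (suc (length ω)))) first-term)
                (concatMap-cong shift (upTo (suc (length ω)))))
    where
    first-term : word (q ++ []) ш word (reverse (π∞W (x ∷ ω))) ≡ shW q (reverse (π∞W ω) ++ [ π∞ x ])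
    first-term = trans (word-ш-word (q ++ []) (reverse (π∞W (x ∷ ω))))
      (cong₂ shW (List.++-identityʳ q) (unfold-reverse (π∞ x) (π∞W ω)))
    shift : ∀ i → Rterm q (x ∷ ω) (suc i) ≡ Rterm (q ++ [ x ]) ω i
    shift i = cong (λ t → scale (sgn (length ω ∸ i)) (word t ш word (reverse (π∞W (drop i ω)))))
      (sym (List.++-assoc q [ x ] (take i ω)))

  RHSₚ-∷ : ∀ q x ω → RHSₚ q (x ∷ ω) ≡
    scale (sgn (length ω)) [ shW q (reverse (π∞W ω)) ∣ π⁰ x ] ++ RHSₚ (q ++ [ x ]) ω
  RHSₚ-∷ q x ω = trans (concatMap-allFin-suc (length ω) (RHSterm q (x ∷ ω)))
    (cong₂ _++_ (cong (λ c → scale (sgn (length ω)) [ c ∣ π⁰ x ]) first-term)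
                (concatMap-cong shift (allFin (length ω))))
    where
    first-term : word (q ++ []) ш word (reverse (π∞W ω)) ≡ shW q (reverse (π∞W ω))
    first-term = trans (word-ш-word (q ++ []) (reverse (π∞W ω)))
      (cong (λ t → shW t (reverse (π∞W ω))) (List.++-identityʳ q))
    shift : ∀ j → RHSterm q (x ∷ ω) (fsuc j) ≡ RHSterm (q ++ [ x ]) ω j
    shift j = cong (λ t → scale (sgn (length ω ∸ suc (toℕ j)))
        [ word t ш word (reverse (π∞W (drop (suc (toℕ j)) ω))) ∣ π⁰ (lookup ω j) ])
      (sym (List.++-assoc q [ x ] (take (toℕ j) ω)))

  mutual
    Rₚ-∷ʳ : ∀ q a ω → Rₚ (q ++ [ a ]) ω ≈T
      scale (sgn (length ω)) [ shW q (reverse (π∞W ω)) ∣ a ] ++ RHSₚ (q ++ [ a ]) ω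
    Rₚ-∷ʳ q a [] = ≡⇒≈T (cong (λ c → scale 1ℚ c ++ []) last-letter)
      where
      last-letter : word ((q ++ [ a ]) ++ []) ш word [] ≡ [ shW q [] ∣ a ]
      last-letter = trans (word-ш-word ((q ++ [ a ]) ++ []) [])
        (trans (cong (λ t → shW t []) (List.++-identityʳ (q ++ [ a ])))
        (trans (shW-[] (q ++ [ a ])) (cong [_∣ a ] (sym (shW-[] q)))))
    Rₚ-∷ʳ q a (x ∷ ω) = begin
        Rₚ (q ++ [ a ]) (x ∷ ω)
      ≡⟨ Rₚ-∷ (q ++ [ a ]) x ω ⟩
        scale s′ (shW (q ++ [ a ]) (V ++ [ π∞ x ])) ++ Rest
      ≈⟨ ∙-congʳ (scale-cong s′ (shW-∷ʳ q V a (π∞ x))) ⟩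
        scale s′ ([ shW q (V ++ [ π∞ x ]) ∣ a ] ++ [ shW (q ++ [ a ]) V ∣ π∞ x ]) ++ Rest
      ≡⟨ cong (_++ Rest) (scale-++ s′ [ shW q (V ++ [ π∞ x ]) ∣ a ] [ shW (q ++ [ a ]) V ∣ π∞ x ]) ⟩
        (A ++ scale s′ [ shW (q ++ [ a ]) V ∣ π∞ x ]) ++ Rest
      ≈⟨ assoc A (scale s′ [ shW (q ++ [ a ]) V ∣ π∞ x ]) Rest ⟩
        A ++ (scale s′ [ shW (q ++ [ a ]) V ∣ π∞ x ] ++ Rest)
      ≈⟨ ∙-congˡ {A} (Rₚ-telescope (q ++ [ a ]) x ω) ⟩
        A ++ RHSₚ (q ++ [ a ]) (x ∷ ω)
      ≡⟨ cong (λ v → scale s′ [ shW q v ∣ a ] ++ RHSₚ (q ++ [ a ]) (x ∷ ω)) (unfold-reverse (π∞ x) (π∞W ω)) ⟨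
        scale s′ [ shW q (reverse (π∞W (x ∷ ω))) ∣ a ] ++ RHSₚ (q ++ [ a ]) (x ∷ ω) ∎
      where
      V = reverse (π∞W ω)
      s′ = sgn (suc (length ω))
      A = scale s′ [ shW q (V ++ [ π∞ x ]) ∣ a ]
      Rest = Rₚ ((q ++ [ a ]) ++ [ x ]) ω

    Rₚ-telescope : ∀ q x ω →
      scale (sgn (suc (length ω))) [ shW q (reverse (π∞W ω)) ∣ π∞ x ] ++ Rₚ (q ++ [ x ]) ω ≈T RHSₚ q (x ∷ ω)
    Rₚ-telescope q x ω = begin
        B ++ Rₚ (q ++ [ x ]) ω
      ≈⟨ ∙-congˡ {B} (Rₚ-∷ʳ q x ω) ⟩
        B ++ (C ++ Rest)
      ≈⟨ assoc B C Rest ⟨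
        (B ++ C) ++ Rest
      ≈⟨ ∙-congʳ (sgn-telescope (length ω) (shW q V) x) ⟩
        scale (sgn (length ω)) [ shW q V ∣ π⁰ x ] ++ Rest
      ≡⟨ RHSₚ-∷ q x ω ⟨
        RHSₚ q (x ∷ ω) ∎
      where
      V = reverse (π∞W ω)
      B = scale (sgn (suc (length ω))) [ shW q V ∣ π∞ x ]
      C = scale (sgn (length ω)) [ shW q V ∣ x ]
      Rest = RHSₚ (q ++ [ x ]) ω

  -- Rₚ-telescope applies because shW [] (v ++ [ b ]) and [ shW [] v ∣ b ] are both word (v ++ [ b ]).
  R≈RHS : ∀ x ω → R (x ∷ ω) ≈T RHS (x ∷ ω)
  R≈RHS x ω = ≈-trans (≡⇒≈T (Rₚ-∷ [] x ω)) (Rₚ-telescope [] x ω)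

mainTheorem9 : ∀ {m ℓ : Level} (W : QVectorSpace m ℓ) (D : Decomposition W)
    (ω : List (Module.Carrierᴹ W)) → 1 ≤ length ω →
    TensorCoalgebra._≈T_ W D (TensorCoalgebra.R W D ω) (TensorCoalgebra.RHS W D ω)
mainTheorem9 W D (x ∷ ω) _ = R≈RHS W D x ω
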